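{- Let $b\ge2$ and $g\ge3$ be integers and fix signs $s,t\in\{+1,-1\}$. Let $(d_1,d_2,l,m,n)$ be integers with $1\le d_1,d_2\le g-1$, $n\ge0$, $l,m\ge1$, satisfying $$(b+s)b^n+t=d_1\frac{g^l-1}{g-1}-d_2\frac{g^m-1}{g-1}.$$ Then $\Lambda_3:=\dfrac{(b+s)b^n(g-1)}{d_1g^l}-1\ne0$. -}

module Defs where

open import Data.Nat as ℕ using (ℕ; suc)
open import Data.Integer as ℤ using (ℤ; +_)
open import Data.Rational as ℚ using (ℚ)

-- The rational number (g^k - 1)/(g - 1), for g = suc (suc h) ≥ 2
-- (the denominator g - 1 = suc h is then a nonzero natural).
repunitQ : (h k : ℕ) → ℚ
repunitQ h k = ((+ (suc (suc h) ℕ.^ k)) ℤ.- ℤ.1ℤ) ℚ./ suc h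

Λ₃ : (b s : ℤ) (n g d₁ l : ℕ) → .{{_ : ℕ.NonZero (d₁ ℕ.* g ℕ.^ l)}} → ℚ
Λ₃ b s n g d₁ l =
  (((b ℤ.+ s) ℤ.* (b ℤ.^ n) ℤ.* ((+ g) ℤ.- ℤ.1ℤ)) ℚ./ (d₁ ℕ.* g ℕ.^ l)) ℚ.- ℚ.1ℚ

-- Λ₃ = 0 says (b+s)bⁿ(g−1) = d₁gˡ. Subtracting this from the hypothesis multiplied by g−1
-- cancels both (b+s)bⁿ and gˡ, leaving d₂gᵐ + d₁ = d₂ − t(g−1) ≤ d₂ + (g−1). But the left side
-- exceeds d₂g ≥ d₂ + (g−1), since m ≥ 1 and d₁ ≥ 1.
module Submission where

open import Defs
open import Data.Nat as ℕ using (ℕ; suc; NonZero)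
open import Data.Integer as ℤ using (ℤ; +_)
open import Data.Rational as ℚ using (ℚ)
open import Data.Sum using (_⊎_; inj₁; inj₂)
open import Data.List using ([]; _∷_)
open import Relation.Binary.PropositionalEquality
  using (_≡_; _≢_; refl; sym; trans; cong; cong₂; subst; module ≡-Reasoning)
import Data.Nat.Properties as ℕ
import Data.Integer.Properties as ℤ
open import Data.Integer.Tactic.RingSolver using (solve)
import Data.Rational.Properties as ℚ
open import Data.Rational.Unnormalised as ℚᵘ using (mkℚᵘ; *≡*)
  renaming (_≃_ to _≃ᵘ_)
import Data.Rational.Unnormalised.Properties as ℚᵘ

toℚᵘ-/ : ∀ i n .{{_ : NonZero n}} → ℚ.toℚᵘ (i ℚ./ n) ≃ᵘ i ℚᵘ./ n
toℚᵘ-/ i (suc k) = ℚ.toℚᵘ-fromℚᵘ (mkℚᵘ i k)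

toℚᵘ-homo-− : ∀ p q → ℚ.toℚᵘ (p ℚ.- q) ≃ᵘ ℚ.toℚᵘ p ℚᵘ.- ℚ.toℚᵘ q
toℚᵘ-homo-− p q = ℚᵘ.≃-trans (ℚ.toℚᵘ-homo-+ p (ℚ.- q)) (ℚᵘ.+-congʳ (ℚ.toℚᵘ p) (ℚ.toℚᵘ-homo‿- q))

/-1≡0⇒≡ : ∀ i n .{{_ : NonZero n}} → (i ℚ./ n) ℚ.- ℚ.1ℚ ≡ ℚ.0ℚ → i ≡ + n
/-1≡0⇒≡ i n@(suc _) eq with ℚᵘ.p-q≃0⇒p≃q (i ℚᵘ./ n) ℚᵘ.1ℚᵘ (begin
  (i ℚᵘ./ n) ℚᵘ.- ℚᵘ.1ℚᵘ                 ≈⟨ ℚᵘ.+-cong (toℚᵘ-/ i n) (ℚᵘ.-‿cong (toℚᵘ-/ (+ 1) 1)) ⟨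
  ℚ.toℚᵘ (i ℚ./ n) ℚᵘ.- ℚ.toℚᵘ ℚ.1ℚ      ≈⟨ toℚᵘ-homo-− (i ℚ./ n) ℚ.1ℚ ⟨
  ℚ.toℚᵘ ((i ℚ./ n) ℚ.- ℚ.1ℚ)            ≈⟨ ℚ.toℚᵘ-cong eq ⟩
  ℚᵘ.0ℚᵘ                                 ∎)
  where open ℚᵘ.≃-Reasoning
... | *≡* i*1≡1*n = trans (sym (ℤ.*-identityʳ i)) (trans i*1≡1*n (ℤ.*-identityˡ (+ n)))

-- The hypothesis is the cross-multiplied form of y/1 ≃ p/H + q/H in unnormalised rationals.
cancel-common-denominator : ∀ y p q H .{{_ : ℤ.NonZero H}} →
  y ℤ.* ((+ 1 ℤ.* H) ℤ.* (+ 1 ℤ.* H)) ≡ (p ℤ.* (+ 1 ℤ.* H) ℤ.+ q ℤ.* (+ 1 ℤ.* H)) ℤ.* + 1 →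
  y ℤ.* H ≡ p ℤ.+ q
cancel-common-denominator y p q H eq = ℤ.*-cancelʳ-≡ _ _ H (begin
  (y ℤ.* H) ℤ.* H                                     ≡⟨ solve (y ∷ H ∷ []) ⟩
  y ℤ.* ((+ 1 ℤ.* H) ℤ.* (+ 1 ℤ.* H))                 ≡⟨ eq ⟩
  (p ℤ.* (+ 1 ℤ.* H) ℤ.+ q ℤ.* (+ 1 ℤ.* H)) ℤ.* + 1   ≡⟨ solve (p ∷ q ∷ H ∷ []) ⟩
  (p ℤ.+ q) ℤ.* H                                     ∎)
  where open ≡-Reasoning

/1≡combination⇒ : ∀ x a c i j h →
  x ℚ./ 1 ≡ (a ℚ./ 1) ℚ.* (i ℚ./ suc h) ℚ.- (c ℚ./ 1) ℚ.* (j ℚ./ suc h) →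
  x ℤ.* + suc h ≡ a ℤ.* i ℤ.- c ℤ.* j
/1≡combination⇒ x a c i j h eq with begin
  x ℚᵘ./ 1                                     ≈⟨ toℚᵘ-/ x 1 ⟨
  ℚ.toℚᵘ (x ℚ./ 1)                             ≈⟨ ℚ.toℚᵘ-cong eq ⟩
  ℚ.toℚᵘ (a′ ℚ.* i′ ℚ.- c′ ℚ.* j′)             ≈⟨ toℚᵘ-homo-− (a′ ℚ.* i′) (c′ ℚ.* j′) ⟩
  ℚ.toℚᵘ (a′ ℚ.* i′) ℚᵘ.- ℚ.toℚᵘ (c′ ℚ.* j′)   ≈⟨ ℚᵘ.+-cong (toℚᵘ-product a i) (ℚᵘ.-‿cong (toℚᵘ-product c j)) ⟩
  (a ℚᵘ./ 1) ℚᵘ.* (i ℚᵘ./ suc h) ℚᵘ.- (c ℚᵘ./ 1) ℚᵘ.* (j ℚᵘ./ suc h) ∎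
  where
  open ℚᵘ.≃-Reasoning
  a′ c′ i′ j′ : ℚ
  a′ = a ℚ./ 1; c′ = c ℚ./ 1; i′ = i ℚ./ suc h; j′ = j ℚ./ suc h
  toℚᵘ-product : ∀ u v → ℚ.toℚᵘ ((u ℚ./ 1) ℚ.* (v ℚ./ suc h)) ≃ᵘ (u ℚᵘ./ 1) ℚᵘ.* (v ℚᵘ./ suc h)
  toℚᵘ-product u v = ℚᵘ.≃-trans (ℚ.toℚᵘ-homo-* (u ℚ./ 1) (v ℚ./ suc h))
                       (ℚᵘ.*-cong (toℚᵘ-/ u 1) (toℚᵘ-/ v (suc h)))
... | *≡* cross = cancel-common-denominator x (a ℤ.* i) (ℤ.- (c ℤ.* j)) (+ suc h) cross

eliminate-leading-terms : ∀ x t h d₁ d₂ p q →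
  (x ℤ.+ t) ℤ.* h ≡ d₁ ℤ.* (p ℤ.- ℤ.1ℤ) ℤ.- d₂ ℤ.* (q ℤ.- ℤ.1ℤ) →
  x ℤ.* h ≡ d₁ ℤ.* p →
  d₂ ℤ.* q ℤ.+ d₁ ≡ d₂ ℤ.- t ℤ.* h
eliminate-leading-terms x t h d₁ d₂ p q eq₁ eq₂ = begin
  d₂ ℤ.* q ℤ.+ d₁                                                       ≡⟨ solve (d₁ ∷ d₂ ∷ p ∷ q ∷ []) ⟩
  d₂ ℤ.- (d₁ ℤ.* (p ℤ.- ℤ.1ℤ) ℤ.- d₂ ℤ.* (q ℤ.- ℤ.1ℤ) ℤ.- d₁ ℤ.* p)    ≡⟨ cong₂ (λ u v → d₂ ℤ.- (u ℤ.- v)) eq₁ eq₂ ⟨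
  d₂ ℤ.- ((x ℤ.+ t) ℤ.* h ℤ.- x ℤ.* h)                                  ≡⟨ solve (x ∷ t ∷ h ∷ d₂ ∷ []) ⟩
  d₂ ℤ.- t ℤ.* h                                                        ∎
  where open ≡-Reasoning

-t*n≤n : ∀ {t} → t ≡ ℤ.1ℤ ⊎ t ≡ ℤ.-1ℤ → ∀ n → ℤ.- (t ℤ.* + n) ℤ.≤ + n
-t*n≤n (inj₁ refl) n = subst (λ u → ℤ.- u ℤ.≤ + n) (sym (ℤ.*-identityˡ (+ n))) ℤ.neg-≤-pos
-t*n≤n (inj₂ refl) n = ℤ.≤-reflexive (trans (cong ℤ.-_ (ℤ.-1*i≡-i (+ n))) (ℤ.neg-involutive (+ n)))

m+n<m*o+p : ∀ {m n o p} → 0 ℕ.< p → 0 ℕ.< m → n ℕ.< o → m ℕ.+ n ℕ.< m ℕ.* o ℕ.+ p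
m+n<m*o+p {m@(suc _)} {n} {o} {p} 0<p _ n<o = begin-strict
  m ℕ.+ n        ≤⟨ ℕ.+-monoʳ-≤ m (ℕ.m≤n*m n m) ⟩
  m ℕ.+ m ℕ.* n  ≡⟨ ℕ.*-suc m n ⟨
  m ℕ.* suc n    ≤⟨ ℕ.*-monoʳ-≤ m n<o ⟩
  m ℕ.* o        <⟨ ℕ.m<m+n (m ℕ.* o) 0<p ⟩
  m ℕ.* o ℕ.+ p  ∎
  where open ℕ.≤-Reasoning

no-small-digit-solution : ∀ {t d₁ d₂ h q} → t ≡ ℤ.1ℤ ⊎ t ≡ ℤ.-1ℤ →
  0 ℕ.< d₁ → 0 ℕ.< d₂ → h ℕ.< q → + d₂ ℤ.* + q ℤ.+ + d₁ ≢ + d₂ ℤ.- t ℤ.* + h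
no-small-digit-solution {t} {d₁} {d₂} {h} {q} t≡±1 0<d₁ 0<d₂ h<q eq = ℤ.<-irrefl refl (begin-strict
  + d₂ ℤ.* + q ℤ.+ + d₁   ≡⟨ eq ⟩
  + d₂ ℤ.- t ℤ.* + h      ≤⟨ ℤ.+-monoʳ-≤ (+ d₂) (-t*n≤n t≡±1 h) ⟩
  + d₂ ℤ.+ + h            ≡⟨ ℤ.pos-+ d₂ h ⟨
  + (d₂ ℕ.+ h)            <⟨ ℤ.+<+ (m+n<m*o+p 0<d₁ 0<d₂ h<q) ⟩
  + (d₂ ℕ.* q ℕ.+ d₁)     ≡⟨ trans (ℤ.pos-+ (d₂ ℕ.* q) d₁) (cong (ℤ._+ + d₁) (ℤ.pos-* d₂ q)) ⟩
  + d₂ ℤ.* + q ℤ.+ + d₁   ∎)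
  where open ℤ.≤-Reasoning

lemma12 : (b g : ℕ) (s t : ℤ) (d₁ d₂ l m n : ℕ) →
          2 ℕ.≤ b → 3 ℕ.≤ g →
          (s ≡ ℤ.1ℤ ⊎ s ≡ ℤ.-1ℤ) → (t ≡ ℤ.1ℤ ⊎ t ≡ ℤ.-1ℤ) →
          1 ℕ.≤ d₁ → d₁ ℕ.≤ g ℕ.∸ 1 → 1 ℕ.≤ d₂ → d₂ ℕ.≤ g ℕ.∸ 1 →
          1 ℕ.≤ l → 1 ℕ.≤ m →
          ((((+ b) ℤ.+ s) ℤ.* ((+ b) ℤ.^ n) ℤ.+ t) ℚ./ 1
                ≡ (((+ d₁) ℚ./ 1) ℚ.* repunitQ (g ℕ.∸ 2) l)
                  ℚ.- (((+ d₂) ℚ./ 1) ℚ.* repunitQ (g ℕ.∸ 2) m)) →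
          (nz : NonZero (d₁ ℕ.* g ℕ.^ l)) →
          Λ₃ (+ b) s n g d₁ l {{nz}} ≢ ℚ.0ℚ
lemma12 b (suc (suc h)) s t d₁ d₂ l m n _ (ℕ.s≤s (ℕ.s≤s _)) _ t≡±1 0<d₁ _ 0<d₂ _ _ 1≤m hypothesis nz Λ₃≡0 =
  no-small-digit-solution t≡±1 0<d₁ 0<d₂ g-1<g^m digit-equation
  where
  g : ℕ
  g = suc (suc h)
  x : ℤ
  x = ((+ b) ℤ.+ s) ℤ.* ((+ b) ℤ.^ n)
  repunit-equation : (x ℤ.+ t) ℤ.* + suc h
                   ≡ + d₁ ℤ.* (+ (g ℕ.^ l) ℤ.- ℤ.1ℤ) ℤ.- + d₂ ℤ.* (+ (g ℕ.^ m) ℤ.- ℤ.1ℤ)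
  repunit-equation = /1≡combination⇒ (x ℤ.+ t) (+ d₁) (+ d₂) _ _ h hypothesis
  Λ₃-equation : x ℤ.* + suc h ≡ + d₁ ℤ.* + (g ℕ.^ l)
  Λ₃-equation = trans (/-1≡0⇒≡ _ _ {{nz}} Λ₃≡0) (ℤ.pos-* d₁ (g ℕ.^ l))
  digit-equation : + d₂ ℤ.* + (g ℕ.^ m) ℤ.+ + d₁ ≡ + d₂ ℤ.- t ℤ.* + suc h
  digit-equation = eliminate-leading-terms x t (+ suc h) (+ d₁) (+ d₂) (+ (g ℕ.^ l)) (+ (g ℕ.^ m))
                     repunit-equation Λ₃-equation
  g-1<g^m : suc h ℕ.< g ℕ.^ m
  g-1<g^m = subst (ℕ._≤ g ℕ.^ m) (ℕ.^-identityʳ g) (ℕ.^-monoʳ-≤ g 1≤m)
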